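{- Let $s$ be a string with Lyndon runs $F_1,\dots,F_m$. Consider a tandem domain $\mathrm{dom}_{e+1}(F_k)$, $\mathrm{dom}_e(F_{k+1})$ such that both $\mathrm{dom}_{e+1}(F_k)$ and $\mathrm{dom}_e(F_{k+1})$ are subdomains of a domain $\mathrm{dom}_d(F_i)$. Then the substring associated with the tandem domain $\mathrm{dom}_{e+1}(F_k)$, $\mathrm{dom}_e(F_{k+1})$ does not overlap the substring associated with $\mathrm{dom}_d(F_i)$.
   Context: Let $s=f_1^{e_1}\cdots f_m^{e_m}$ be the Lyndon factorization of $s$ (each $f_i$ a Lyndon word, i.e. a nonempty string strictly lexicographically smaller than all its nonempty proper suffixes; $e_i\ge1$; $f_i\succ f_{i+1}$) and $F_i=f_i^{e_i}$ the Lyndon runs, viewed as consecutive substrings of $s$. For $d\ge1$, $1\le i\le m-d+1$, the leftmost occurrence of $F_i\cdots F_{i+d-1}$ in $s$ begins at the first position of some run $F_j$, $j\le i$; $\mathrm{dom}_d(F_i)=F_j\cdots F_{i-1}$ (empty if $j=i$) and $\mathrm{extdom}_d(F_i)=F_j\cdots F_{i+d-1}$, as substrings (positions) of $s$; the substring associated with $\mathrm{dom}_d(F_i)$ is that leftmost occurrence of $F_i\cdots F_{i+d-1}$. The pair $\mathrm{dom}_{e+1}(F_k)$, $\mathrm{dom}_e(F_{k+1})$ is a tandem domain if $\mathrm{extdom}_{e+1}(F_k)=\mathrm{extdom}_e(F_{k+1})$; then $F_k=F_{k+1}\cdots F_{k+e}x$ for some $x$, the leftmost occurrence of $F_k\cdots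 F_{k+e}$ reads $F_{k+1}\cdots F_{k+e}\,x\,F_{k+1}\cdots F_{k+e}$, and the occurrence of $xF_{k+1}\cdots F_{k+e}$ forming its suffix is the substring associated with the tandem domain. A domain $\mathrm{dom}_e(F_k)$ is a subdomain of $\mathrm{dom}_d(F_i)=F_j\cdots F_{i-1}$ if either $(k,e)=(i,d)$, or $j\le k<i$ and $k+e\le i+d$ (equivalently $\mathrm{extdom}_e(F_k)$ is a substring of $\mathrm{extdom}_d(F_i)$). -}

module Defs where

open import Data.Nat using (ℕ; zero; suc; _+_; _≤_; _<_)
open import Data.List using (List; []; _∷_; _++_; length; take; drop; replicate; concat)
open import Data.List.Relation.Binary.Lex.Strict using (Lex-<)
open import Data.Product using (_×_; Σ; ∃; _,_)
open import Data.Sum using (_⊎_)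
open import Relation.Nullary using (¬_)
open import Relation.Binary.PropositionalEquality using (_≡_; _≢_)

-- Strings over an ordered alphabet; we take the alphabet to be ℕ
-- (any string uses finitely many letters of a totally ordered alphabet,
-- so it embeds order-preservingly into ℕ).
Str : Set
Str = List ℕ

_≺_ : Str → Str → Set
_≺_ = Lex-< _≡_ _<_

Lyndon : Str → Set
Lyndon w = (w ≢ []) × (∀ n → 0 < n → n < length w → w ≺ drop n w)

-- A family of runs: indices 0 .. m-1 (0-based; the paper's F_1..F_m is our F 0 .. F (m-1)).
-- f t is the Lyndon word f_{t+1}, ex t the exponent e_{t+1}.
record Runs : Set where
  field
    m  : ℕ
    f  : ℕ → Str
    ex : ℕ → ℕ

  F : ℕ → Str
  F t = concat (replicate (ex t) (f t))

  prefixRuns : ℕ → Str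
  prefixRuns zero    = []
  prefixRuns (suc n) = prefixRuns n ++ F n

  start : ℕ → ℕ
  start zero    = 0
  start (suc t) = start t + length (F t)

  seg : ℕ → ℕ → Str
  seg i zero    = []
  seg i (suc d) = F i ++ seg (suc i) d

open Runs public

IsLyndonFactorization : Str → Runs → Set
IsLyndonFactorization s R =
    (∀ t → t < m R → Lyndon (f R t))
  × (∀ t → t < m R → 1 ≤ ex R t)
  × (∀ t → suc t < m R → f R (suc t) ≺ f R t)
  × (s ≡ prefixRuns R (m R))

OccursAt : Str → Str → ℕ → Set
OccursAt s u p = take (length u) (drop p s) ≡ u

Leftmost : Str → Str → ℕ → Set
Leftmost s u p = OccursAt s u p × (∀ q → q < p → ¬ OccursAt s u q)

-- dom_d(F_i) = F_j ⋯ F_(i-1): the leftmost occurrence of F_i⋯F_(i+d-1)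
-- in s begins at the first position of run F_j, with j ≤ i.
-- (Only meaningful for 1 ≤ d and i + d ≤ m, imposed where used.)
DomStart : Str → Runs → ℕ → ℕ → ℕ → Set
DomStart s R i d j = (j ≤ i) × Leftmost s (seg R i d) (start R j)

-- half-open intervals of positions [a , b)
Interval : Set
Interval = ℕ × ℕ

-- extdom_d(F_i) = F_j ⋯ F_(i+d-1) as an interval of positions of s
extdom : Runs → ℕ → ℕ → ℕ → Interval
extdom R i d j = start R j , start R (i + d)

-- the substring associated with dom_d(F_i): the leftmost occurrence
-- of F_i ⋯ F_(i+d-1), which starts at start j
domSub : Runs → ℕ → ℕ → ℕ → Interval
domSub R i d j = start R j , start R j + length (seg R i d)

-- the substring associated with the tandem domain dom_(e+1)(F_k), dom_e(F_(k+1))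
-- (where j is the common start run): the leftmost occurrence of
-- F_k ⋯ F_(k+e) reads F_(k+1)⋯F_(k+e) x F_(k+1)⋯F_(k+e); the associated
-- substring is the suffix x F_(k+1)⋯F_(k+e), i.e. the part after the
-- initial F_(k+1)⋯F_(k+e).
tandemSub : Runs → ℕ → ℕ → ℕ → Interval
tandemSub R k e j =
  start R j + length (seg R (suc k) e) , start R j + length (seg R k (suc e))

Overlap : Interval → Interval → Set
Overlap (a , b) (c , d) = ∃ λ q → (a ≤ q × q < b) × (c ≤ q × q < d)

Subdomain : (k e : ℕ) → (i d j : ℕ) → Set
Subdomain k e i d j = ((k ≡ i) × (e ≡ d)) ⊎ ((j ≤ k) × (k < i) × (k + e ≤ i + d))

-- The substring of the tandem domain begins right after the prefix
-- F_(k+1)⋯F_(k+e) of its leftmost occurrence, while the substring of dom_d(F_i)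
-- ends where the leftmost occurrence of F_i⋯F_(i+d-1) ends.  So it suffices
-- that F_i⋯F_(i+d-1) is a prefix of F_(k+1)⋯F_(k+e): then it occurs where the
-- latter does, hence no later than there.  The subdomain conditions leave only
-- k+1 = i, d = e (trivial) and j ≤ k < k+1 < i.  In the last case any other
-- relation between the two segments is impossible in a Lyndon factorization:
-- a suffix of s at a factor boundary is never beaten at a mismatch by an
-- earlier suffix, and no run F_i starts with a Lyndon word larger than f_i.
module Submission where

open import Defs
open import Data.Nat using (ℕ; zero; suc; _+_; _∸_; _≤_; _<_; z≤n; s≤s)
open import Data.Nat.Properties
open import Data.List using (List; []; _∷_; _++_; [_]; length; take; drop; replicate; concat)
open import Data.List.Properties
  using (length-++; length-++-≤ˡ; length-drop; concat-++; ++-assoc; ++-identityʳ; drop-drop; take++drop≡id)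
open import Data.List.Relation.Binary.Lex.Core using (base; halt; this; next)
open import Data.List.Relation.Binary.Lex.Strict using (<-transitive)
open import Data.List.Relation.Unary.All as All using (All; []; _∷_)
import Data.List.Relation.Unary.All.Properties as Allₚ
open import Data.List.Relation.Unary.AllPairs using (AllPairs; []; _∷_)
import Data.List.Relation.Unary.AllPairs.Properties as AllPairsₚ
open import Data.Product using (_×_; ∃; ∃₂; _,_; proj₁; proj₂)
open import Data.Sum using (_⊎_; inj₁; inj₂)
open import Data.Empty using (⊥-elim)
open import Relation.Nullary using (¬_)
open import Relation.Binary.Definitions using (Transitive; tri<; tri≈; tri>)
open import Relation.Binary.PropositionalEquality hiding ([_])

infix 4 _⊑_ _<ᵈ_ _≼_ _≽_

_⊑_ : Str → Str → Set
u ⊑ v = ∃ λ r → v ≡ u ++ r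

⊑-refl : ∀ u → u ⊑ u
⊑-refl u = [] , sym (++-identityʳ u)

⊑-trans : ∀ {u v w} → u ⊑ v → v ⊑ w → u ⊑ w
⊑-trans {u} (r , refl) (r′ , refl) = r ++ r′ , ++-assoc u r r′

⊑-++ʳ : ∀ {u v} w → u ⊑ v → u ⊑ v ++ w
⊑-++ʳ {u} w (r , refl) = r ++ w , ++-assoc u r w

⊑⇒length-≤ : ∀ {u v} → u ⊑ v → length u ≤ length v
⊑⇒length-≤ {u} (r , refl) = length-++-≤ˡ u

-- u <ᵈ v: u and v first differ at a position where both have a letter, u's
-- being the smaller one.  Unlike _≺_ this survives appending anything to
-- either side.
data _<ᵈ_ : Str → Str → Set where
  here  : ∀ {x y xs ys} → x < y → x ∷ xs <ᵈ y ∷ ys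
  there : ∀ {x xs ys} → xs <ᵈ ys → x ∷ xs <ᵈ x ∷ ys

<ᵈ-irrefl : ∀ {u} → ¬ u <ᵈ u
<ᵈ-irrefl (here x<x) = <-irrefl refl x<x
<ᵈ-irrefl (there p)  = <ᵈ-irrefl p

<ᵈ-trans : Transitive _<ᵈ_
<ᵈ-trans (here x<y) (here y<z) = here (<-trans x<y y<z)
<ᵈ-trans (here x<y) (there _)  = here x<y
<ᵈ-trans (there _)  (here y<z) = here y<z
<ᵈ-trans (there p)  (there q)  = there (<ᵈ-trans p q)

<ᵈ-asym : ∀ {u v} → u <ᵈ v → ¬ v <ᵈ u
<ᵈ-asym p q = <ᵈ-irrefl (<ᵈ-trans p q)

<ᵈ-++ˡ : ∀ {u v} w → u <ᵈ v → u ++ w <ᵈ v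
<ᵈ-++ˡ w (here x<y) = here x<y
<ᵈ-++ˡ w (there p)  = there (<ᵈ-++ˡ w p)

<ᵈ-++ʳ : ∀ {u v} w → u <ᵈ v → u <ᵈ v ++ w
<ᵈ-++ʳ w (here x<y) = here x<y
<ᵈ-++ʳ w (there p)  = there (<ᵈ-++ʳ w p)

<ᵈ-extend : ∀ {u v x y} → u ⊑ x → v ⊑ y → u <ᵈ v → x <ᵈ y
<ᵈ-extend (a , refl) (b , refl) p = <ᵈ-++ʳ b (<ᵈ-++ˡ a p)

⊑-common⇒¬<ᵈ : ∀ {u v w} → u ⊑ w → v ⊑ w → ¬ u <ᵈ v
⊑-common⇒¬<ᵈ u⊑w v⊑w p = <ᵈ-irrefl (<ᵈ-extend u⊑w v⊑w p)

<ᵈ-cancelˡ : ∀ w {u v} → w ++ u <ᵈ w ++ v → u <ᵈ v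
<ᵈ-cancelˡ []      p            = p
<ᵈ-cancelˡ (x ∷ w) (here x<x)   = ⊥-elim (<-irrefl refl x<x)
<ᵈ-cancelˡ (x ∷ w) (there p)    = <ᵈ-cancelˡ w p

_≼_ : Str → Str → Set
u ≼ v = u ⊑ v ⊎ u <ᵈ v

_≽_ : Str → Str → Set
u ≽ v = v ≼ u

≼-∷ : ∀ x {u v} → u ≼ v → x ∷ u ≼ x ∷ v
≼-∷ x (inj₁ (r , refl)) = inj₁ (r , refl)
≼-∷ x (inj₂ p)          = inj₂ (there p)

≼-++ʳ : ∀ {u v} w → u ≼ v → u ≼ v ++ w
≼-++ʳ w (inj₁ p) = inj₁ (⊑-++ʳ w p)
≼-++ʳ w (inj₂ p) = inj₂ (<ᵈ-++ʳ w p)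

⊑-<ᵈ-trans : ∀ {u v w} → u ⊑ v → v <ᵈ w → u ≼ w
⊑-<ᵈ-trans {[]}    {w = w} _ _     = inj₁ (w , refl)
⊑-<ᵈ-trans {x ∷ u} (r , refl) (here x<y) = inj₂ (here x<y)
⊑-<ᵈ-trans {x ∷ u} (r , refl) (there p)  = ≼-∷ x (⊑-<ᵈ-trans (r , refl) p)

≼-<ᵈ-trans : ∀ {u v w} → u ≼ v → v <ᵈ w → u ≼ w
≼-<ᵈ-trans (inj₁ u⊑v) v<w = ⊑-<ᵈ-trans u⊑v v<w
≼-<ᵈ-trans (inj₂ u<v) v<w = inj₂ (<ᵈ-trans u<v v<w)

≼-total : ∀ u v → u ≼ v ⊎ v ≼ u
≼-total []      v       = inj₁ (inj₁ (v , refl))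
≼-total (x ∷ u) []      = inj₂ (inj₁ (x ∷ u , refl))
≼-total (x ∷ u) (y ∷ v) with <-cmp x y
... | tri< x<y _ _ = inj₁ (inj₂ (here x<y))
... | tri> _ _ y<x = inj₂ (inj₂ (here y<x))
... | tri≈ _ refl _ with ≼-total u v
...   | inj₁ u≼v = inj₁ (≼-∷ x u≼v)
...   | inj₂ v≼u = inj₂ (≼-∷ x v≼u)

≺-trans : Transitive _≺_
≺-trans = <-transitive isEquivalence <-resp₂-≡ <-trans

≺⇒<ᵈ⊎proper-⊑ : ∀ {u v} → u ≺ v → u <ᵈ v ⊎ ∃ λ r → r ≢ [] × v ≡ u ++ r
≺⇒<ᵈ⊎proper-⊑ (base ())
≺⇒<ᵈ⊎proper-⊑ {v = y ∷ ys} halt = inj₂ (y ∷ ys , (λ ()) , refl)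
≺⇒<ᵈ⊎proper-⊑ (this x<y)      = inj₁ (here x<y)
≺⇒<ᵈ⊎proper-⊑ (next refl p) with ≺⇒<ᵈ⊎proper-⊑ p
... | inj₁ q                  = inj₁ (there q)
... | inj₂ (r , r≢[] , refl) = inj₂ (r , r≢[] , refl)

≺⇒≼ : ∀ {u v} → u ≺ v → u ≼ v
≺⇒≼ u≺v with ≺⇒<ᵈ⊎proper-⊑ u≺v
... | inj₁ u<v          = inj₂ u<v
... | inj₂ (r , _ , eq) = inj₁ (r , eq)

≢[]⇒0<length : ∀ {w : Str} → w ≢ [] → 0 < length w
≢[]⇒0<length {[]}    w≢[] = ⊥-elim (w≢[] refl)
≢[]⇒0<length {_ ∷ _} _    = s≤s z≤n

Lyndon-nonempty : ∀ {w} → Lyndon w → 0 < length w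
Lyndon-nonempty (w≢[] , _) = ≢[]⇒0<length w≢[]

-- A proper suffix is too short to have w as a prefix.
Lyndon-<ᵈ-drop : ∀ {w n} → Lyndon w → 0 < n → n < length w → w <ᵈ drop n w
Lyndon-<ᵈ-drop {w} {n} (_ , minimal) 0<n n<|w| with ≺⇒<ᵈ⊎proper-⊑ (minimal n 0<n n<|w|)
... | inj₁ w<suffix     = w<suffix
... | inj₂ (r , _ , eq) = ⊥-elim (<⇒≱ shorter (⊑⇒length-≤ (r , eq)))
  where
  shorter : length (drop n w) < length w
  shorter = subst (_< length w) (sym (length-drop n w)) (∸-monoʳ-< 0<n (<⇒≤ n<|w|))

Lyndon-≼-drop : ∀ {g h n} → Lyndon h → g ≼ h → n < length h → g ≼ drop n h
Lyndon-≼-drop {n = zero}  _  g≼h _  = g≼h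
Lyndon-≼-drop {n = suc n} Lh g≼h n< = ≼-<ᵈ-trans g≼h (Lyndon-<ᵈ-drop Lh (s≤s z≤n) n<)

drop-length-++ : ∀ (u v : Str) → drop (length u) (u ++ v) ≡ v
drop-length-++ []      v = refl
drop-length-++ (x ∷ u) v = drop-length-++ u v

take-length-++ : ∀ (u v : Str) → take (length u) (u ++ v) ≡ u
take-length-++ []      v = refl
take-length-++ (x ∷ u) v = cong (x ∷_) (take-length-++ u v)

drop-++ˡ : ∀ n (u v : Str) → n ≤ length u → drop n (u ++ v) ≡ drop n u ++ v
drop-++ˡ zero    u       v _         = refl
drop-++ˡ (suc n) (x ∷ u) v (s≤s n≤u) = drop-++ˡ n u v n≤u

drop-++-cases : ∀ (u v : Str) n → n < length (u ++ v) →
                (n < length u × drop n (u ++ v) ≡ drop n u ++ v)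
              ⊎ (∃ λ n′ → n′ < length v × drop n (u ++ v) ≡ drop n′ v)
drop-++-cases []      v n       n<       = inj₂ (n , n< , refl)
drop-++-cases (x ∷ u) v zero    _        = inj₁ (s≤s z≤n , refl)
drop-++-cases (x ∷ u) v (suc n) (s≤s n<) with drop-++-cases u v n n<
... | inj₁ (n<u , eq)       = inj₁ (s≤s n<u , eq)
... | inj₂ (n′ , n′<v , eq) = inj₂ (n′ , n′<v , eq)

drop-concat : ∀ {P : Str → Set} {hs} → All P hs → ∀ {n} → n < length (concat hs) →
              ∃ λ h → P h × ∃ λ o → o < length h × ∃ λ Y → drop n (concat hs) ≡ drop o h ++ Y
drop-concat {hs = h ∷ hs} (ph ∷ phs) {n} n< with drop-++-cases h (concat hs) n n<
... | inj₁ (n<h , eq)       = h , ph , n , n<h , concat hs , eq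
... | inj₂ (n′ , n′<hs , eq) with drop-concat phs n′<hs
...   | h′ , ph′ , o , o<h′ , Y , eq′ = h′ , ph′ , o , o<h′ , Y , trans eq eq′

concat-snoc : ∀ hs (g : Str) → concat (hs ++ [ g ]) ≡ concat hs ++ g
concat-snoc hs g = trans (sym (concat-++ hs [ g ])) (cong (concat hs ++_) (++-identityʳ g))

⊑-drop-++ : ∀ {s u v p} → u ++ v ⊑ drop p s → v ⊑ drop (p + length u) s
⊑-drop-++ {s} {u} {v} {p} (Y , eq) = Y , (begin
  drop (p + length u) s          ≡⟨ drop-drop p (length u) s ⟨
  drop (length u) (drop p s)     ≡⟨ cong (drop (length u)) eq ⟩
  drop (length u) ((u ++ v) ++ Y) ≡⟨ cong (drop (length u)) (++-assoc u v Y) ⟩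
  drop (length u) (u ++ v ++ Y)  ≡⟨ drop-length-++ u (v ++ Y) ⟩
  v ++ Y                         ∎)
  where open ≡-Reasoning

occursAt⇒⊑ : ∀ {s u p} → OccursAt s u p → u ⊑ drop p s
occursAt⇒⊑ {s} {u} {p} occ =
  drop (length u) (drop p s) ,
  trans (sym (take++drop≡id (length u) (drop p s))) (cong (_++ drop (length u) (drop p s)) occ)

⊑⇒occursAt : ∀ {s u p} → u ⊑ drop p s → OccursAt s u p
⊑⇒occursAt {u = u} (r , eq) = trans (cong (take (length u)) eq) (take-length-++ u r)

leftmost-≤ : ∀ {s u p q} → Leftmost s u p → OccursAt s u q → p ≤ q
leftmost-≤ (_ , none-earlier) occ = ≮⇒≥ (λ q<p → none-earlier _ q<p occ)

≤⇒¬Overlap : ∀ {a b c d} → d ≤ a → ¬ Overlap (a , b) (c , d)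
≤⇒¬Overlap d≤a (q , (a≤q , _) , (_ , q<d)) = <-irrefl refl (<-≤-trans q<d (≤-trans d≤a a≤q))

AllPairs-++⁻-across : ∀ {R : Str → Str → Set} xs {ys} → AllPairs R (xs ++ ys) →
                      All (λ x → All (R x) ys) xs
AllPairs-++⁻-across []       _            = []
AllPairs-++⁻-across (x ∷ xs) (Rx ∷ Rxs) = Allₚ.++⁻ʳ xs Rx ∷ AllPairs-++⁻-across xs Rxs

AllPairs-replicate : ∀ {R : Str → Str → Set} {x} n → R x x → AllPairs R (replicate n x)
AllPairs-replicate zero    _   = []
AllPairs-replicate (suc n) Rxx = Allₚ.replicate⁺ n Rxx ∷ AllPairs-replicate n Rxx

replicate-pred : ∀ {n} {x : Str} → 1 ≤ n → replicate n x ≡ x ∷ replicate (n ∸ 1) x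
replicate-pred {suc n} _ = refl

drop-concat-≽ : ∀ {g hs n} w → All (λ h → Lyndon h × g ≼ h) hs → n < length (concat hs) →
                g ≼ drop n (concat hs ++ w)
drop-concat-≽ {g} {hs} {n} w bounds n< with drop-concat bounds n<
... | h , (Lh , g≼h) , o , o<h , Y , eq =
  subst (g ≼_) (sym (trans (drop-++ˡ n (concat hs) w (<⇒≤ n<)) (cong (_++ w) eq)))
        (≼-++ʳ w (≼-++ʳ Y (Lyndon-≼-drop Lh g≼h o<h)))

sorted-Lyndon-prefix-≽-next : ∀ hs {g gs} → All Lyndon (hs ++ g ∷ gs) → AllPairs _≽_ (hs ++ g ∷ gs) →
                              All (λ h → Lyndon h × g ≼ h) hs
sorted-Lyndon-prefix-≽-next hs lyndon sorted =
  All.zip (Allₚ.++⁻ˡ hs lyndon , All.map All.head (AllPairs-++⁻-across hs sorted))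

-- A suffix starting inside some h ≽ g either begins with g or beats g at a
-- mismatch; in the first case move g across the boundary and recurse.
sorted-Lyndon-boundary-minimal :
  ∀ hs gs → All Lyndon (hs ++ gs) → AllPairs _≽_ (hs ++ gs) →
  ∀ {n} → n < length (concat hs) → ¬ drop n (concat hs ++ concat gs) <ᵈ concat gs
sorted-Lyndon-boundary-minimal hs []       _      _      _  ()
sorted-Lyndon-boundary-minimal hs (g ∷ gs) lyndon sorted {n} n< X<G
  with drop-concat-≽ (g ++ concat gs) (sorted-Lyndon-prefix-≽-next hs lyndon sorted) n<
... | inj₂ g<X = <ᵈ-asym X<G (<ᵈ-++ˡ (concat gs) g<X)
... | inj₁ (Z , X≡gZ) =
  sorted-Lyndon-boundary-minimal (hs ++ [ g ]) gs
    (subst (All Lyndon) (sym (++-assoc hs [ g ] gs)) lyndon)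
    (subst (AllPairs _≽_) (sym (++-assoc hs [ g ] gs)) sorted)
    (subst (n + length g <_) (sym (trans (cong length (concat-snoc hs g)) (length-++ (concat hs))))
           (+-monoˡ-< (length g) n<))
    (subst (_<ᵈ concat gs) (sym drop≡Z) (<ᵈ-cancelˡ g (subst (_<ᵈ g ++ concat gs) X≡gZ X<G)))
  where
  open ≡-Reasoning
  drop≡Z : drop (n + length g) (concat (hs ++ [ g ]) ++ concat gs) ≡ Z
  drop≡Z = begin
    drop (n + length g) (concat (hs ++ [ g ]) ++ concat gs)
      ≡⟨ cong (λ x → drop (n + length g) (x ++ concat gs)) (concat-snoc hs g) ⟩
    drop (n + length g) ((concat hs ++ g) ++ concat gs)
      ≡⟨ cong (drop (n + length g)) (++-assoc (concat hs) g (concat gs)) ⟩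
    drop (n + length g) (concat hs ++ g ++ concat gs)
      ≡⟨ drop-drop n (length g) _ ⟨
    drop (length g) (drop n (concat hs ++ g ++ concat gs))
      ≡⟨ cong (drop (length g)) X≡gZ ⟩
    drop (length g) (g ++ Z)
      ≡⟨ drop-length-++ g Z ⟩
    Z ∎

module _ (R : Runs) where

  factors : ℕ → ℕ → List Str
  factors t zero    = []
  factors t (suc n) = replicate (ex R t) (f R t) ++ factors (suc t) n

  factors-+ : ∀ t a b → factors t (a + b) ≡ factors t a ++ factors (t + a) b
  factors-+ t zero    b rewrite +-identityʳ t = refl
  factors-+ t (suc a) b rewrite +-suc t a =
    trans (cong (replicate (ex R t) (f R t) ++_) (factors-+ (suc t) a b))
          (sym (++-assoc (replicate (ex R t) (f R t)) (factors (suc t) a) (factors (suc t + a) b)))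

  concat-factors : ∀ t n → concat (factors t n) ≡ seg R t n
  concat-factors t zero    = refl
  concat-factors t (suc n) =
    trans (sym (concat-++ (replicate (ex R t) (f R t)) (factors (suc t) n)))
          (cong (F R t ++_) (concat-factors (suc t) n))

  seg-+ : ∀ t a b → seg R t (a + b) ≡ seg R t a ++ seg R (t + a) b
  seg-+ t a b = begin
    seg R t (a + b)                                       ≡⟨ concat-factors t (a + b) ⟨
    concat (factors t (a + b))                            ≡⟨ cong concat (factors-+ t a b) ⟩
    concat (factors t a ++ factors (t + a) b)             ≡⟨ concat-++ (factors t a) _ ⟨
    concat (factors t a) ++ concat (factors (t + a) b)    ≡⟨ cong₂ _++_ (concat-factors t a) (concat-factors (t + a) b) ⟩
    seg R t a ++ seg R (t + a) b                          ∎
    where open ≡-Reasoning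

  prefixRuns≡seg : ∀ t → prefixRuns R t ≡ seg R 0 t
  prefixRuns≡seg zero    = refl
  prefixRuns≡seg (suc t) = begin
    prefixRuns R t ++ F R t      ≡⟨ cong₂ _++_ (prefixRuns≡seg t) (sym (++-identityʳ (F R t))) ⟩
    seg R 0 t ++ seg R t 1       ≡⟨ seg-+ 0 t 1 ⟨
    seg R 0 (t + 1)              ≡⟨ cong (seg R 0) (+-comm t 1) ⟩
    seg R 0 (suc t)              ∎
    where open ≡-Reasoning

  start≡length-seg : ∀ t → start R t ≡ length (seg R 0 t)
  start≡length-seg t = trans (start≡length-prefixRuns t) (cong length (prefixRuns≡seg t))
    where
    start≡length-prefixRuns : ∀ t → start R t ≡ length (prefixRuns R t)
    start≡length-prefixRuns zero    = refl
    start≡length-prefixRuns (suc t) =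
      trans (cong (_+ length (F R t)) (start≡length-prefixRuns t)) (sym (length-++ (prefixRuns R t)))

  start-mono : ∀ {a} b → a ≤ b → start R a ≤ start R b
  start-mono zero    z≤n  = ≤-refl
  start-mono (suc b) a≤1+b with m≤n⇒m<n∨m≡n a≤1+b
  ... | inj₁ a<1+b = ≤-trans (start-mono b (≤-pred a<1+b)) (m≤m+n (start R b) _)
  ... | inj₂ refl  = ≤-refl

  f⊑F : ∀ {t} → 1 ≤ ex R t → f R t ⊑ F R t
  f⊑F {t} 1≤ex = concat (replicate (ex R t ∸ 1) (f R t)) , cong concat (replicate-pred 1≤ex)

  FactorBoundary : ℕ → Set
  FactorBoundary p = ∃₂ λ hs gs → hs ++ gs ≡ factors 0 (m R) × length (concat hs) ≡ p

  start-boundary : ∀ {t} → t ≤ m R → FactorBoundary (start R t)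
  start-boundary {t} t≤m with m≤n⇒∃[o]m+o≡n t≤m
  ... | z , t+z≡m =
    factors 0 t , factors t z ,
    trans (sym (factors-+ 0 t z)) (cong (factors 0) t+z≡m) ,
    trans (cong length (concat-factors 0 t)) (sym (start≡length-seg t))

  after-first-factor-boundary : ∀ {t} → t < m R → 1 ≤ ex R t → FactorBoundary (start R t + length (f R t))
  after-first-factor-boundary {t} t<m 1≤ex with m≤n⇒∃[o]m+o≡n t<m
  ... | z , 1+t+z≡m =
    factors 0 t ++ [ f R t ] , replicate (ex R t ∸ 1) (f R t) ++ factors (suc t) z ,
    (begin
      (factors 0 t ++ [ f R t ]) ++ rest                       ≡⟨ ++-assoc (factors 0 t) _ rest ⟩
      factors 0 t ++ f R t ∷ rest                              ≡⟨ cong (λ x → factors 0 t ++ x ++ factors (suc t) z) (replicate-pred 1≤ex) ⟨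
      factors 0 t ++ factors t (suc z)                         ≡⟨ factors-+ 0 t (suc z) ⟨
      factors 0 (t + suc z)                                    ≡⟨ cong (factors 0) (trans (+-suc t z) 1+t+z≡m) ⟩
      factors 0 (m R)                                          ∎) ,
    (begin
      length (concat (factors 0 t ++ [ f R t ]))               ≡⟨ cong length (concat-snoc (factors 0 t) (f R t)) ⟩
      length (concat (factors 0 t) ++ f R t)                   ≡⟨ length-++ (concat (factors 0 t)) ⟩
      length (concat (factors 0 t)) + length (f R t)           ≡⟨ cong (λ x → length x + length (f R t)) (concat-factors 0 t) ⟩
      length (seg R 0 t) + length (f R t)                      ≡⟨ cong (_+ length (f R t)) (start≡length-seg t) ⟨
      start R t + length (f R t)                               ∎)
    where
    open ≡-Reasoning
    rest : List Str
    rest = replicate (ex R t ∸ 1) (f R t) ++ factors (suc t) z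

module _ {s : Str} {R : Runs} (LF : IsLyndonFactorization s R) where

  f-Lyndon : ∀ {t} → t < m R → Lyndon (f R t)
  f-Lyndon {t} = proj₁ LF t

  ex-positive : ∀ {t} → t < m R → 1 ≤ ex R t
  ex-positive {t} = proj₁ (proj₂ LF) t

  f-step : ∀ {t} → suc t < m R → f R (suc t) ≺ f R t
  f-step {t} = proj₁ (proj₂ (proj₂ LF)) t

  f-decreasing : ∀ {a b} → a < b → b < m R → f R b ≺ f R a
  f-decreasing {a} {suc b} a<1+b 1+b<m with m≤n⇒m<n∨m≡n (≤-pred a<1+b)
  ... | inj₁ a<b  = ≺-trans (f-step 1+b<m) (f-decreasing a<b (<-trans (n<1+n b) 1+b<m))
  ... | inj₂ refl = f-step 1+b<m

  f-antitone : ∀ {a b} → a ≤ b → b < m R → f R b ≼ f R a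
  f-antitone a≤b b<m with m≤n⇒m<n∨m≡n a≤b
  ... | inj₁ a<b  = ≺⇒≼ (f-decreasing a<b b<m)
  ... | inj₂ refl = inj₁ (⊑-refl _)

  s≡seg : s ≡ seg R 0 (m R)
  s≡seg = trans (proj₂ (proj₂ (proj₂ LF))) (prefixRuns≡seg R (m R))

  s≡concat-factors : s ≡ concat (factors R 0 (m R))
  s≡concat-factors = trans s≡seg (sym (concat-factors R 0 (m R)))

  factors-All : ∀ {P : Str → Set} t n → (∀ {u} → t ≤ u → u < t + n → P (f R u)) → All P (factors R t n)
  factors-All t zero    _   = []
  factors-All t (suc n) P-f =
    Allₚ.++⁺ (Allₚ.replicate⁺ (ex R t) (P-f ≤-refl (m<m+n t (s≤s z≤n))))
             (factors-All (suc t) n (λ {u} t<u u< → P-f (<⇒≤ t<u) (subst (u <_) (sym (+-suc t n)) u<)))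

  factors-sorted : ∀ t n → t + n ≤ m R → AllPairs _≽_ (factors R t n)
  factors-sorted t zero    _     = []
  factors-sorted t (suc n) t+n≤m =
    AllPairsₚ.++⁺ (AllPairs-replicate (ex R t) (inj₁ (⊑-refl (f R t))))
                  (factors-sorted (suc t) n 1+t+n≤m)
                  (Allₚ.replicate⁺ (ex R t)
                    (factors-All (suc t) n (λ t<u u< → f-antitone (<⇒≤ t<u) (<-≤-trans u< 1+t+n≤m))))
    where
    1+t+n≤m : suc t + n ≤ m R
    1+t+n≤m = subst (_≤ m R) (+-suc t n) t+n≤m

  boundary-suffix-minimal : ∀ {p q} → FactorBoundary R p → q < p → ¬ drop q s <ᵈ drop p s
  boundary-suffix-minimal (hs , gs , hs++gs≡ , refl) q<p
    rewrite s≡concat-factors | sym hs++gs≡ | sym (concat-++ hs gs) | drop-length-++ (concat hs) (concat gs) =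
    sorted-Lyndon-boundary-minimal hs gs
      (subst (All Lyndon) (sym hs++gs≡) (factors-All 0 (m R) (λ _ u<m → f-Lyndon u<m)))
      (subst (AllPairs _≽_) (sym hs++gs≡) (factors-sorted 0 (m R) ≤-refl))
      q<p

  seg-at-start : ∀ {t n} → t + n ≤ m R → seg R t n ⊑ drop (start R t) s
  seg-at-start {t} {n} t+n≤m with m≤n⇒∃[o]m+o≡n t+n≤m
  ... | z , t+n+z≡m = seg R (t + n) z , (begin
    drop (start R t) s                                        ≡⟨ cong₂ drop (start≡length-seg R t) s≡seg ⟩
    drop (length (seg R 0 t)) (seg R 0 (m R))                 ≡⟨ cong (λ x → drop (length (seg R 0 t)) (seg R 0 x)) m≡ ⟩
    drop (length (seg R 0 t)) (seg R 0 (t + (n + z)))         ≡⟨ cong (drop (length (seg R 0 t))) (seg-+ R 0 t (n + z)) ⟩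
    drop (length (seg R 0 t)) (seg R 0 t ++ seg R t (n + z))  ≡⟨ drop-length-++ (seg R 0 t) _ ⟩
    seg R t (n + z)                                           ≡⟨ seg-+ R t n z ⟩
    seg R t n ++ seg R (t + n) z                              ∎)
    where
    open ≡-Reasoning
    m≡ : m R ≡ t + (n + z)
    m≡ = trans (sym t+n+z≡m) (+-assoc t n z)

  f⊑seg : ∀ {t n} → t < m R → 1 ≤ n → f R t ⊑ seg R t n
  f⊑seg {n = suc n} t<m _ = ⊑-++ʳ _ (f⊑F R (ex-positive t<m))

  start-< : ∀ {a b} → a < b → b ≤ m R → start R a < start R b
  start-< {a} {b} a<b b≤m = <-≤-trans (m<m+n (start R a) 0<|F|) (start-mono R b a<b)
    where
    a<m : a < m R
    a<m = <-≤-trans a<b b≤m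
    0<|F| : 0 < length (F R a)
    0<|F| = <-≤-trans (Lyndon-nonempty (f-Lyndon a<m)) (⊑⇒length-≤ (f⊑F R (ex-positive a<m)))

  f⊑run-start : ∀ {t} → t < m R → f R t ⊑ drop (start R t) s
  f⊑run-start {t} t<m = ⊑-trans (f⊑seg {n = 1} t<m (s≤s z≤n)) (seg-at-start {t} {1} (subst (_≤ m R) (+-comm 1 t) t<m))

  -- If f_t ≺ u, either f_t and u mismatch, impossible for two prefixes of one
  -- string, or u = f_t r with u <ᵈ r since u is Lyndon; then the suffix of s
  -- after the first f_t would beat the one at start t.
  run-start-no-greater-Lyndon : ∀ {t u} → t < m R → Lyndon u → f R t ≺ u → ¬ u ⊑ drop (start R t) s
  run-start-no-greater-Lyndon {t} {u} t<m Lu ft≺u u⊑X with ≺⇒<ᵈ⊎proper-⊑ ft≺u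
  ... | inj₁ ft<u = ⊑-common⇒¬<ᵈ (f⊑run-start t<m) u⊑X ft<u
  ... | inj₂ (r , r≢[] , refl) =
    boundary-suffix-minimal (after-first-factor-boundary R t<m (ex-positive t<m))
      (m<m+n (start R t) 0<|ft|) (<ᵈ-extend u⊑X (⊑-drop-++ {s} {p = start R t} u⊑X) u<r)
    where
    0<|ft| : 0 < length (f R t)
    0<|ft| = Lyndon-nonempty (f-Lyndon t<m)
    u<r : f R t ++ r <ᵈ r
    u<r = subst (f R t ++ r <ᵈ_) (drop-length-++ (f R t) r)
            (Lyndon-<ᵈ-drop Lu 0<|ft|
              (subst (length (f R t) <_) (sym (length-++ (f R t))) (m<m+n (length (f R t)) (≢[]⇒0<length r≢[]))))

  -- A mismatch between the two segments would put a smaller suffix before a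
  -- run start; seg a e being a prefix of seg b d would put the Lyndon word
  -- f_a ≻ f_b at the start of run b.
  seg-⊑-earlier-seg : ∀ {j a b e d} → j < a → a < b → a + e ≤ m R → b + d ≤ m R → 1 ≤ e → 1 ≤ d →
                      OccursAt s (seg R b d) (start R j) → seg R b d ⊑ seg R a e
  seg-⊑-earlier-seg {j} {a} {b} {e} {d} j<a a<b a+e≤m b+d≤m 1≤e 1≤d occ = by-cases (≼-total (seg R b d) (seg R a e))
    where
    b<m : b < m R
    b<m = <-≤-trans (m<m+n b 1≤d) b+d≤m
    a<m : a < m R
    a<m = <-trans a<b b<m
    w⊑at-j : seg R b d ⊑ drop (start R j) s
    w⊑at-j = occursAt⇒⊑ {s} {p = start R j} occ
    w⊑at-b : seg R b d ⊑ drop (start R b) s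
    w⊑at-b = seg-at-start {b} {d} b+d≤m
    T⊑at-a : seg R a e ⊑ drop (start R a) s
    T⊑at-a = seg-at-start {a} {e} a+e≤m
    by-cases : seg R b d ≼ seg R a e ⊎ seg R a e ≼ seg R b d → seg R b d ⊑ seg R a e
    by-cases (inj₁ (inj₁ w⊑T)) = w⊑T
    by-cases (inj₁ (inj₂ w<T)) = ⊥-elim (boundary-suffix-minimal (start-boundary R (<⇒≤ a<m))
                                   (start-< j<a (<⇒≤ a<m)) (<ᵈ-extend w⊑at-j T⊑at-a w<T))
    by-cases (inj₂ (inj₁ T⊑w)) = ⊥-elim (run-start-no-greater-Lyndon b<m (f-Lyndon a<m) (f-decreasing a<b b<m)
                                   (⊑-trans (f⊑seg a<m 1≤e) (⊑-trans T⊑w w⊑at-b)))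
    by-cases (inj₂ (inj₂ T<w)) = ⊥-elim (boundary-suffix-minimal (start-boundary R (<⇒≤ b<m))
                                   (start-< a<b (<⇒≤ b<m)) (<ᵈ-extend T⊑at-a w⊑at-b T<w))

  dom-seg-⊑-tandem-seg : ∀ {k e i d j} → 1 ≤ e → k + suc e ≤ m R → 1 ≤ d → i + d ≤ m R →
                         OccursAt s (seg R i d) (start R j) →
                         Subdomain k (suc e) i d j → Subdomain (suc k) e i d j → seg R i d ⊑ seg R (suc k) e
  dom-seg-⊑-tandem-seg _ _ _ _ _ (inj₁ (refl , _)) (inj₁ (1+k≡k , _))     = ⊥-elim (1+n≢n 1+k≡k)
  dom-seg-⊑-tandem-seg _ _ _ _ _ (inj₁ (refl , _)) (inj₂ (_ , 1+k<k , _)) = ⊥-elim (<-asym (n<1+n _) 1+k<k)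
  dom-seg-⊑-tandem-seg _ _ _ _ _ (inj₂ _)          (inj₁ (refl , refl))  = ⊑-refl _
  dom-seg-⊑-tandem-seg {k} {e} 1≤e k+1+e≤m 1≤d i+d≤m occ (inj₂ (j≤k , _ , _)) (inj₂ (_ , 1+k<i , _)) =
    seg-⊑-earlier-seg (s≤s j≤k) 1+k<i (subst (_≤ m R) (+-suc k e) k+1+e≤m) i+d≤m 1≤e 1≤d occ

lemma11 : (s : Str) (R : Runs) → IsLyndonFactorization s R →
    (k e jk jk′ : ℕ) → 1 ≤ e → k + suc e ≤ m R →
    DomStart s R k (suc e) jk → DomStart s R (suc k) e jk′ →
    extdom R k (suc e) jk ≡ extdom R (suc k) e jk′ →
    (i d j : ℕ) → 1 ≤ d → i + d ≤ m R → DomStart s R i d j →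
    Subdomain k (suc e) i d j → Subdomain (suc k) e i d j →
    ¬ Overlap (tandemSub R k e jk) (domSub R i d j)
lemma11 s R LF k e jk jk′ 1≤e k+1+e≤m _ (_ , T-leftmost) extdom≡ i d j 1≤d i+d≤m (_ , w-leftmost) sub sub′ =
  ≤⇒¬Overlap (+-mono-≤ (leftmost-≤ w-leftmost (⊑⇒occursAt {s} {p = start R jk} w⊑X)) (⊑⇒length-≤ w⊑T))
  where
  w⊑T : seg R i d ⊑ seg R (suc k) e
  w⊑T = dom-seg-⊑-tandem-seg LF 1≤e k+1+e≤m 1≤d i+d≤m (proj₁ w-leftmost) sub sub′
  T⊑X : seg R (suc k) e ⊑ drop (start R jk) s
  T⊑X = subst (λ p → seg R (suc k) e ⊑ drop p s) (sym (cong proj₁ extdom≡)) (occursAt⇒⊑ {s} {p = start R jk′} (proj₁ T-leftmost))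
  w⊑X : seg R i d ⊑ drop (start R jk) s
  w⊑X = ⊑-trans w⊑T T⊑X
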